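{- Let $t$ be a positive integer and $G$ a finite simple graph. Let $d=\min\{\gamma_{t,1}(\vec{G})\}$ and $D=\max\{\gamma_{t,1}(\vec{G})\}$, where $\vec{G}$ ranges over all orientations of $G$. Then for every integer $b$ with $d\le b\le D$ there exists an orientation $\vec{G}_b$ of $G$ with $\gamma_{t,1}(\vec{G}_b)=b$.
   Context: An orientation $\vec{G}$ of a graph $G$ assigns to every edge $\{u,v\}$ exactly one direction. For vertices $u,v$ of $\vec{G}$, $d(u,v)$ is the minimum length of a directed path from $u$ to $v$ ($d(u,u)=0$; $\infty$ if none exists). Given positive integers $t,r$ and $S\subseteq V(\vec{G})$, the directed reception at $w$ is $\vec{r}(w)=\sum_{v\in S,\ d(v,w)<t}(t-d(v,w))$; $S$ is a directed $(t,r)$ broadcast dominating set if $\vec{r}(w)\ge r$ for every vertex $w$, and $\gamma_{t,r}(\vec{G})$ is the minimum cardinality of such a set. -}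

module Defs where

open import Data.Nat using (ℕ; zero; suc; _+_; _∸_; _≤_; _<_)
open import Data.Bool using (Bool; true; false; _∧_; _∨_; if_then_else_)
open import Data.Fin using (Fin; _≟_)
open import Data.Fin.Subset using (Subset; ∣_∣)
open import Data.Vec using (lookup)
open import Data.List using (List; map; allFin; foldr)
open import Data.Nat.ListAction using (sum)
open import Data.Maybe using (Maybe; just; nothing)
open import Data.Product using (Σ; _×_; ∃)
open import Data.Sum using (_⊎_)
open import Relation.Nullary using (¬_)
open import Relation.Nullary.Decidable using (⌊_⌋)
open import Relation.Binary.PropositionalEquality using (_≡_)

record Graph (n : ℕ) : Set where
  field
    adj   : Fin n → Fin n → Bool
    sym   : ∀ u v → adj u v ≡ adj v u
    loopless : ∀ v → adj v v ≡ false
open Graph public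

record Orientation {n : ℕ} (G : Graph n) : Set where
  field
    arc      : Fin n → Fin n → Bool
    arc⇒edge : ∀ u v → arc u v ≡ true → adj G u v ≡ true
    edge⇒arc : ∀ u v → adj G u v ≡ true → (arc u v ≡ true ⊎ arc v u ≡ true)
    oneDir   : ∀ u v → ¬ (arc u v ≡ true × arc v u ≡ true)
open Orientation public

anyFin : {n : ℕ} → (Fin n → Bool) → Bool
anyFin {n} p = foldr (λ x b → p x ∨ b) false (allFin n)

module _ {n : ℕ} {G : Graph n} (O : Orientation G) where

  reachLe : ℕ → Fin n → Fin n → Bool
  reachLe zero    u w = ⌊ u ≟ w ⌋
  reachLe (suc k) u w = reachLe k u w ∨ anyFin (λ x → reachLe k u x ∧ arc O x w)

  distSearch : ℕ → ℕ → Fin n → Fin n → Maybe ℕ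
  distSearch zero     k u w = if reachLe k u w then just k else nothing
  distSearch (suc f)  k u w = if reachLe k u w then just k else distSearch f (suc k) u w

  -- directed distance d(u,w); nothing encodes ∞.  Checking lengths 0..n
  -- suffices since a shortest directed path has at most n-1 arcs.
  dist : Fin n → Fin n → Maybe ℕ
  dist u w = distSearch n 0 u w

  contrib : ℕ → Fin n → Fin n → ℕ
  contrib t v w with dist v w
  ... | just d  = t ∸ d
  ... | nothing = 0

  reception : ℕ → Subset n → Fin n → ℕ
  reception t S w = sum (map (λ v → if lookup S v then contrib t v w else 0) (allFin n))

  IsBroadcastDom : ℕ → ℕ → Subset n → Set
  IsBroadcastDom t r S = ∀ w → r ≤ reception t S w

  IsGamma : ℕ → ℕ → ℕ → Set
  IsGamma t r k =
    Σ (Subset n) (λ S → IsBroadcastDom t r S × ∣ S ∣ ≡ k)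
    × (∀ S → IsBroadcastDom t r S → k ≤ ∣ S ∣)

IsMinGammaOver : {n : ℕ} → Graph n → ℕ → ℕ → ℕ → Set
IsMinGammaOver G t r d =
  Σ (Orientation G) (λ O → IsGamma O t r d)
  × (∀ (O : Orientation G) k → IsGamma O t r k → d ≤ k)

IsMaxGammaOver : {n : ℕ} → Graph n → ℕ → ℕ → ℕ → Set
IsMaxGammaOver G t r D =
  Σ (Orientation G) (λ O → IsGamma O t r D)
  × (∀ (O : Orientation G) k → IsGamma O t r k → k ≤ D)

-- A walk of O whose arcs are partly reversed in O′ survives in O′ from the head of its last
-- reversed arc on, so if every arc of O reversed in O′ has its head in R, then any (t,1)
-- broadcast dominating set S of O gives the dominating set S ∪ R of O′.  In particular
-- reversing a single edge raises γ_{t,1} by at most one.  Ordering the edges of G and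
-- switching them one at a time from a minimising to a maximising orientation therefore
-- gives a chain of orientations along which γ_{t,1} climbs from at most d to at least D in
-- steps of at most one, so it takes every value in between.
module Submission where

open import Defs hiding (sym)
open import Data.Nat using (ℕ; zero; suc; _+_; _*_; _≤_; _<_; z≤n; s≤s; _≤?_; _<?_)
open import Data.Nat.Properties
open import Data.Bool using (Bool; true; false; _∧_; _∨_; if_then_else_)
import Data.Bool as Bool
open import Data.Bool.Properties using (∨-zeroʳ; T-≡)
open import Data.Fin using (Fin; toℕ; combine)
import Data.Fin.Properties as Fin
open import Data.Fin.Properties using (toℕ<n; any?; all?)
open import Data.Fin.Subset using (Subset; ∣_∣; _∪_; _∈_; ⁅_⁆; ⊤; ⊥)
open import Data.Fin.Subset.Properties using (anySubset?; ∣p∣≤n; ∈⊤; x∈⁅x⁆; ∣⊥∣≡0; ∣⁅x⁆∣≡1; p⊆p∪q; q⊆p∪q)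
open import Data.Vec using ([]; _∷_; lookup)
open import Data.Vec.Properties using ([]=⇒lookup; lookup⇒[]=)
open import Data.List using (map; allFin; foldr)
import Data.List as List
open import Data.List.Membership.Propositional using () renaming (_∈_ to _∈ˡ_)
open import Data.List.Membership.Propositional.Properties using (∈-allFin)
open import Data.List.Relation.Unary.Any using (here; there)
open import Data.Nat.ListAction using (sum)
open import Data.Maybe using (just; nothing)
open import Data.Product using (Σ; _×_; ∃; _,_; proj₁; proj₂; swap)
open import Data.Product.Properties using (,-injective)
import Data.Product as Product
open import Data.Sum using (_⊎_; inj₁; inj₂)
import Data.Sum as Sum
open import Relation.Nullary using (¬_; yes; no; Dec; does; contradiction)
open import Relation.Nullary.Decidable using (_×-dec_; fromWitness; dec-true; dec-false)
open import Function using (id; Equivalence)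
open import Relation.Binary.PropositionalEquality using (_≡_; refl; sym; trans; cong; cong₂; subst)

∨-true⁻ : ∀ {a b} → a ∨ b ≡ true → a ≡ true ⊎ b ≡ true
∨-true⁻ {true}  _ = inj₁ refl
∨-true⁻ {false} e = inj₂ e

∨-trueˡ : ∀ {a} b → a ≡ true → a ∨ b ≡ true
∨-trueˡ b refl = refl

∨-trueʳ : ∀ a {b} → b ≡ true → a ∨ b ≡ true
∨-trueʳ a refl = ∨-zeroʳ a

∧-true⁻ : ∀ {a b} → a ∧ b ≡ true → a ≡ true × b ≡ true
∧-true⁻ {true}  e = refl , e
∧-true⁻ {false} ()

∧-true⁺ : ∀ {a b} → a ≡ true → b ≡ true → a ∧ b ≡ true
∧-true⁺ refl e = e

true≢false : ¬ (true ≡ false)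
true≢false ()

module _ {A : Set} (p : A → Bool) where

  foldr-∨-true⁻ : ∀ xs → foldr (λ x b → p x ∨ b) false xs ≡ true → ∃ λ x → p x ≡ true
  foldr-∨-true⁻ (x List.∷ xs) e = Sum.[ (x ,_) , foldr-∨-true⁻ xs ]′ (∨-true⁻ e)

  foldr-∨-true⁺ : ∀ {x} xs → x ∈ˡ xs → p x ≡ true → foldr (λ x b → p x ∨ b) false xs ≡ true
  foldr-∨-true⁺ (y List.∷ xs) (here refl) px = ∨-trueˡ _ px
  foldr-∨-true⁺ (y List.∷ xs) (there x∈xs) px = ∨-trueʳ (p y) (foldr-∨-true⁺ xs x∈xs px)

anyFin-true⁻ : ∀ {n} {p : Fin n → Bool} → anyFin p ≡ true → ∃ λ x → p x ≡ true
anyFin-true⁻ {n} {p} = foldr-∨-true⁻ p (allFin n)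

anyFin-true⁺ : ∀ {n} {p : Fin n → Bool} x → p x ≡ true → anyFin p ≡ true
anyFin-true⁺ {n} {p} x = foldr-∨-true⁺ p (allFin n) (∈-allFin x)

module _ {A : Set} (f : A → ℕ) where

  sum-map-pos⁻ : ∀ xs → 0 < sum (map f xs) → ∃ λ x → 0 < f x
  sum-map-pos⁻ (x List.∷ xs) pos with f x in fx
  ... | zero  = sum-map-pos⁻ xs pos
  ... | suc _ = x , subst (0 <_) (sym fx) (s≤s z≤n)

  ≤-sum-map : ∀ {x} xs → x ∈ˡ xs → f x ≤ sum (map f xs)
  ≤-sum-map (y List.∷ xs) (here refl)  = m≤m+n (f y) _
  ≤-sum-map (y List.∷ xs) (there x∈xs) = ≤-trans (≤-sum-map xs x∈xs) (m≤n+m _ (f y))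

∣p∪q∣≤∣p∣+∣q∣ : ∀ {n} (p q : Subset n) → ∣ p ∪ q ∣ ≤ ∣ p ∣ + ∣ q ∣
∣p∪q∣≤∣p∣+∣q∣ []          []          = z≤n
∣p∪q∣≤∣p∣+∣q∣ (true ∷ p)  (true ∷ q)  =
  s≤s (≤-trans (m≤n⇒m≤1+n (∣p∪q∣≤∣p∣+∣q∣ p q)) (≤-reflexive (sym (+-suc _ _))))
∣p∪q∣≤∣p∣+∣q∣ (true ∷ p)  (false ∷ q) = s≤s (∣p∪q∣≤∣p∣+∣q∣ p q)
∣p∪q∣≤∣p∣+∣q∣ (false ∷ p) (true ∷ q)  = ≤-trans (s≤s (∣p∪q∣≤∣p∣+∣q∣ p q)) (≤-reflexive (sym (+-suc _ _)))
∣p∪q∣≤∣p∣+∣q∣ (false ∷ p) (false ∷ q) = ∣p∪q∣≤∣p∣+∣q∣ p q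

least-witness : (P : ℕ → Set) → (∀ m → Dec (P m)) → (∀ {i j} → i ≤ j → P i → P j) →
                ∀ m → P m → ∃ λ k → P k × (∀ j → P j → k ≤ j)
least-witness P P? up zero    p = 0 , p , λ _ _ → z≤n
least-witness P P? up (suc m) p with P? m
... | yes pm = least-witness P P? up m pm
... | no ¬pm = suc m , p , λ j pj → ≰⇒> (λ j≤m → ¬pm (up j≤m pj))

intermediate-value : (g : ℕ → ℕ) → (∀ k → g (suc k) ≤ suc (g k)) →
                     ∀ b N → g 0 ≤ b → b ≤ g N → ∃ λ k → g k ≡ b
intermediate-value g step b zero    lo hi = 0 , ≤-antisym lo hi
intermediate-value g step b (suc N) lo hi with b ≤? g N
... | yes b≤gN = intermediate-value g step b N lo b≤gN
... | no  b≰gN = suc N , ≤-antisym (≤-trans (step N) (≰⇒> b≰gN)) hi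

sortPair : ∀ {n} → Fin n → Fin n → Fin n × Fin n
sortPair x y with x Fin.≤? y
... | yes _ = x , y
... | no  _ = y , x

sortPair-comm : ∀ {n} (x y : Fin n) → sortPair x y ≡ sortPair y x
sortPair-comm x y with x Fin.≤? y | y Fin.≤? x
... | yes x≤y | yes y≤x = cong₂ _,_ (Fin.≤-antisym x≤y y≤x) (Fin.≤-antisym y≤x x≤y)
... | yes _   | no  _   = refl
... | no  _   | yes _   = refl
... | no x≰y  | no y≰x  = contradiction (Fin.≤-total x y) Sum.[ x≰y , y≰x ]′

sortPair-cases : ∀ {n} (x y : Fin n) → sortPair x y ≡ (x , y) ⊎ sortPair x y ≡ (y , x)
sortPair-cases x y with x Fin.≤? y
... | yes _ = inj₁ refl
... | no  _ = inj₂ refl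

unordered-pair : ∀ {n} {x y x′ y′ : Fin n} → sortPair x y ≡ sortPair x′ y′ →
                 (x ≡ x′ × y ≡ y′) ⊎ (x ≡ y′ × y ≡ x′)
unordered-pair {x = x} {y} {x′} {y′} e with sortPair-cases x y | sortPair-cases x′ y′
... | inj₁ p | inj₁ q = inj₁ (,-injective (trans (sym p) (trans e q)))
... | inj₁ p | inj₂ q = inj₂ (,-injective (trans (sym p) (trans e q)))
... | inj₂ p | inj₁ q = inj₂ (swap (,-injective (trans (sym p) (trans e q))))
... | inj₂ p | inj₂ q = inj₁ (swap (,-injective (trans (sym p) (trans e q))))

uncurry-combine-injective : ∀ {m n} (p q : Fin m × Fin n) →
                            Product.uncurry combine p ≡ Product.uncurry combine q → p ≡ q
uncurry-combine-injective (i , j) (k , l) e with Fin.combine-injective i j k l e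
... | refl , refl = refl

edgeRank : ∀ {n} → Fin n → Fin n → ℕ
edgeRank x y = toℕ (Product.uncurry combine (sortPair x y))

edgeRank<n² : ∀ {n} (x y : Fin n) → edgeRank x y < n * n
edgeRank<n² x y = toℕ<n (Product.uncurry combine (sortPair x y))

edgeRank-comm : ∀ {n} (x y : Fin n) → edgeRank x y ≡ edgeRank y x
edgeRank-comm x y = cong (λ p → toℕ (Product.uncurry combine p)) (sortPair-comm x y)

edgeRank-injective : ∀ {n} {x y x′ y′ : Fin n} → edgeRank x y ≡ edgeRank x′ y′ →
                     (x ≡ x′ × y ≡ y′) ⊎ (x ≡ y′ × y ≡ x′)
edgeRank-injective {x = x} {y} {x′} {y′} e =
  unordered-pair (uncurry-combine-injective (sortPair x y) (sortPair x′ y′) (Fin.toℕ-injective e))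

module _ {n : ℕ} {G : Graph n} where

  record Reach (O : Orientation G) (k : ℕ) (u w : Fin n) : Set where
    constructor reach
    field reached : reachLe O k u w ≡ true

  -- The search for d(u,w) stops at n, so only walks of length at most n are seen.
  ReachWithin : Orientation G → ℕ → Fin n → Fin n → Set
  ReachWithin O t u w = ∃ λ j → j < t × j ≤ n × Reach O j u w

  module _ (O : Orientation G) where

    reach-suc : ∀ {k u w} → Reach O k u w → Reach O (suc k) u w
    reach-suc (reach r) = reach (∨-trueˡ _ r)

    reach-step : ∀ {k u x w} → Reach O k u x → arc O x w ≡ true → Reach O (suc k) u w
    reach-step {k} {u} {x} {w} (reach r) a =
      reach (∨-trueʳ (reachLe O k u w) (anyFin-true⁺ x (∧-true⁺ r a)))

    reach-suc⁻ : ∀ {k u w} → Reach O (suc k) u w →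
                 Reach O k u w ⊎ ∃ λ x → Reach O k u x × arc O x w ≡ true
    reach-suc⁻ (reach r) = Sum.map reach (λ (x , e) → x , Product.map reach id (∧-true⁻ e))
                                   (Sum.map₂ anyFin-true⁻ (∨-true⁻ r))

    reach-refl : ∀ k v → Reach O k v v
    reach-refl zero    v = reach (Equivalence.to T-≡ (fromWitness {a? = v Fin.≟ v} refl))
    reach-refl (suc k) v = reach-suc (reach-refl k v)

    distSearch-sound : ∀ f k {u w d} → distSearch O f k u w ≡ just d → Reach O d u w × d ≤ k + f
    distSearch-sound zero k {u} {w} e with reachLe O k u w in r
    distSearch-sound zero k refl | true = reach r , m≤m+n k 0
    distSearch-sound zero k ()   | false
    distSearch-sound (suc f) k {u} {w} e with reachLe O k u w in r
    distSearch-sound (suc f) k refl | true = reach r , m≤m+n k (suc f)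
    ... | false = Product.map₂ (λ d≤ → ≤-trans d≤ (≤-reflexive (sym (+-suc k f))))
                               (distSearch-sound f (suc k) e)

    distSearch-complete : ∀ f k {j u w} → k ≤ j → j ≤ k + f → Reach O j u w →
                          ∃ λ d → distSearch O f k u w ≡ just d × d ≤ j
    distSearch-complete zero k {j} {u} {w} k≤j j≤k (reach r) with reachLe O k u w in r′
    ... | true  = k , refl , k≤j
    ... | false = contradiction (trans (sym r′) (subst (λ i → reachLe O i u w ≡ true) j≡k r)) λ ()
      where j≡k = ≤-antisym (≤-trans j≤k (≤-reflexive (+-identityʳ k))) k≤j
    distSearch-complete (suc f) k {j} {u} {w} k≤j j≤k (reach r) with reachLe O k u w in r′
    ... | true  = k , refl , k≤j
    ... | false with m≤n⇒m<n∨m≡n k≤j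
    ...   | inj₁ k<j  =
      distSearch-complete f (suc k) k<j (≤-trans j≤k (≤-reflexive (+-suc k f))) (reach r)
    ...   | inj₂ refl = contradiction (trans (sym r′) r) λ ()

    dist-sound : ∀ {u w d} → dist O u w ≡ just d → Reach O d u w × d ≤ n
    dist-sound = distSearch-sound n 0

    dist-complete : ∀ {j u w} → j ≤ n → Reach O j u w → ∃ λ d → dist O u w ≡ just d × d ≤ j
    dist-complete = distSearch-complete n 0 z≤n

    contrib-pos⁻ : ∀ {t v w} → 0 < contrib O t v w → ReachWithin O t v w
    contrib-pos⁻ {v = v} {w} pos with dist O v w in e
    ... | just d  = let (r , d≤n) = dist-sound e in
                    d , m∸n≢0⇒n<m (λ t∸d≡0 → <⇒≢ pos (sym t∸d≡0)) , d≤n , r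
    ... | nothing = contradiction pos λ ()

    contrib-pos⁺ : ∀ {t v w} → ReachWithin O t v w → 0 < contrib O t v w
    contrib-pos⁺ (j , j<t , j≤n , r) with dist-complete j≤n r
    ... | d , e , d≤j rewrite e = m<n⇒0<n∸m (≤-<-trans d≤j j<t)

    reception-pos⁻ : ∀ {t S w} → 0 < reception O t S w → ∃ λ v → v ∈ S × 0 < contrib O t v w
    reception-pos⁻ {S = S} pos with sum-map-pos⁻ _ (allFin n) pos
    ... | v , pos′ with lookup S v in e
    ...   | true  = v , lookup⇒[]= v S e , pos′
    ...   | false = contradiction pos′ λ ()

    reception-pos⁺ : ∀ {t S w v} → v ∈ S → 0 < contrib O t v w → 0 < reception O t S w
    reception-pos⁺ {t} {S} {w} {v} v∈S pos = ≤-trans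
      (subst (λ b → 0 < (if b then contrib O t v w else 0)) (sym ([]=⇒lookup v∈S)) pos)
      (≤-sum-map (λ v → if lookup S v then contrib O t v w else 0) (allFin n) (∈-allFin v))

    ⊤-dominating : ∀ {t} → 0 < t → IsBroadcastDom O t 1 ⊤
    ⊤-dominating 0<t w = reception-pos⁺ ∈⊤ (contrib-pos⁺ (0 , 0<t , z≤n , reach-refl 0 w))

    gamma-exists : ∀ {t} → 0 < t → ∃ (IsGamma O t 1)
    gamma-exists {t} 0<t with least-witness Small Small? Small-up n (⊤ , ⊤-dominating 0<t , ∣p∣≤n ⊤)
      where
      Small : ℕ → Set
      Small m = ∃ λ S → IsBroadcastDom O t 1 S × ∣ S ∣ ≤ m
      Small? : ∀ m → Dec (Small m)
      Small? m = anySubset? (λ S → all? (λ w → 1 ≤? reception O t S w) ×-dec (∣ S ∣ ≤? m))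
      Small-up : ∀ {i j} → i ≤ j → Small i → Small j
      Small-up i≤j (S , dom , ∣S∣≤i) = S , dom , ≤-trans ∣S∣≤i i≤j
    ... | k , (S , dom , ∣S∣≤k) , minimal =
      k , (S , dom , ≤-antisym ∣S∣≤k (minimal _ (S , dom , ≤-refl))) ,
      λ S′ dom′ → minimal _ (S′ , dom′ , ≤-refl)

  Reversed : Orientation G → Orientation G → Fin n → Fin n → Set
  Reversed O O′ x y = arc O x y ≡ true × arc O′ x y ≡ false

  HeadsIn : Orientation G → Orientation G → Subset n → Set
  HeadsIn O O′ R = ∀ {x y} → Reversed O O′ x y → y ∈ R

  module _ {O O′ : Orientation G} {R : Subset n} (heads : HeadsIn O O′ R) where

    -- A walk of O either survives in O′ or, cut after its last reversed arc, leaves a walk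
    -- of O′ starting in R.
    reach-transfer : ∀ k {s w} → Reach O k s w → Reach O′ k s w ⊎ ∃ λ y → y ∈ R × Reach O′ k y w
    reach-transfer zero (reach r) = inj₁ (reach r)
    reach-transfer (suc k) {w = w} r with reach-suc⁻ O r
    ... | inj₁ r′ = Sum.map (reach-suc O′) (Product.map₂ (Product.map₂ (reach-suc O′)))
                            (reach-transfer k r′)
    ... | inj₂ (x , r′ , a) with arc O′ x w in a′
    ...   | false = inj₂ (w , heads (a , a′) , reach-refl O′ (suc k) w)
    ...   | true  = Sum.map (λ r″ → reach-step O′ r″ a′)
                            (Product.map₂ (Product.map₂ (λ r″ → reach-step O′ r″ a′)))
                            (reach-transfer k r′)

    dominating-transfer : ∀ {t S} → IsBroadcastDom O t 1 S → IsBroadcastDom O′ t 1 (S ∪ R)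
    dominating-transfer {S = S} dom w with reception-pos⁻ O (dom w)
    ... | v , v∈S , pos with contrib-pos⁻ O pos
    ...   | j , j<t , j≤n , r with reach-transfer j r
    ...     | inj₁ r′ =
      reception-pos⁺ O′ {S = S ∪ R} (p⊆p∪q R v∈S) (contrib-pos⁺ O′ (j , j<t , j≤n , r′))
    ...     | inj₂ (y , y∈R , r′) =
      reception-pos⁺ O′ {S = S ∪ R} (q⊆p∪q S R y∈R) (contrib-pos⁺ O′ (j , j<t , j≤n , r′))

    gamma-transfer : ∀ {t k k′} → IsGamma O t 1 k → IsGamma O′ t 1 k′ → k′ ≤ k + ∣ R ∣
    gamma-transfer ((S , dom , refl) , _) (_ , minimal′) =
      ≤-trans (minimal′ (S ∪ R) (dominating-transfer {S = S} dom)) (∣p∪q∣≤∣p∣+∣q∣ S R)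

  gamma-unreversed : ∀ {O O′ : Orientation G} {t k k′} → (∀ x y → ¬ Reversed O O′ x y) →
                     IsGamma O t 1 k → IsGamma O′ t 1 k′ → k′ ≤ k
  gamma-unreversed {k = k} {k′} none γ γ′ =
    subst (k′ ≤_) (trans (cong (k +_) (∣⊥∣≡0 n)) (+-identityʳ k))
          (gamma-transfer {R = ⊥} (λ {x} {y} rev → contradiction rev (none x y)) γ γ′)

  gamma-cong : ∀ {O O′ : Orientation G} {t k k′} → (∀ x y → arc O x y ≡ arc O′ x y) →
               IsGamma O t 1 k → IsGamma O′ t 1 k′ → k ≡ k′
  gamma-cong {O} {O′} same γ γ′ =
    ≤-antisym (gamma-unreversed (unreversed O′ O (λ x y → sym (same x y))) γ′ γ)
              (gamma-unreversed (unreversed O O′ same) γ γ′)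
    where
    unreversed : ∀ O O′ → (∀ x y → arc O x y ≡ arc O′ x y) → ∀ x y → ¬ Reversed O O′ x y
    unreversed _ _ same x y (a , a′) = true≢false (trans (sym a) (trans (same x y) a′))

  gamma-step : ∀ {O O′ : Orientation G} {t k k′} →
               (∀ {x y x′ y′} → Reversed O O′ x y → Reversed O O′ x′ y′ → y ≡ y′) →
               IsGamma O t 1 k → IsGamma O′ t 1 k′ → k′ ≤ suc k
  gamma-step {O} {O′} {k = k} {k′} unique γ γ′
    with any? (λ x → any? (λ y → (arc O x y Bool.≟ true) ×-dec (arc O′ x y Bool.≟ false)))
  ... | no none = ≤-trans (gamma-unreversed (λ x y rev → none (x , y , rev)) γ γ′) (n≤1+n k)
  ... | yes (x₀ , y₀ , rev₀) =
    subst (k′ ≤_) (trans (cong (k +_) (∣⁅x⁆∣≡1 y₀)) (+-comm k 1))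
          (gamma-transfer (λ rev → subst (_∈ ⁅ y₀ ⁆) (sym (unique rev rev₀)) (x∈⁅x⁆ y₀)) γ γ′)

  module _ (sel : Fin n → Fin n → Bool) (sel-comm : ∀ x y → sel x y ≡ sel y x) (O₁ O₂ : Orientation G) where

    splicedArc : Fin n → Fin n → Bool
    splicedArc x y = if sel x y then arc O₁ x y else arc O₂ x y

    private
      choice-arc⇒edge : ∀ b x y → (if b then arc O₁ x y else arc O₂ x y) ≡ true → adj G x y ≡ true
      choice-arc⇒edge true  = arc⇒edge O₁
      choice-arc⇒edge false = arc⇒edge O₂

      choice-edge⇒arc : ∀ b x y → adj G x y ≡ true →
        (if b then arc O₁ x y else arc O₂ x y) ≡ true ⊎ (if b then arc O₁ y x else arc O₂ y x) ≡ true
      choice-edge⇒arc true  = edge⇒arc O₁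
      choice-edge⇒arc false = edge⇒arc O₂

      choice-oneDir : ∀ b x y →
        ¬ ((if b then arc O₁ x y else arc O₂ x y) ≡ true × (if b then arc O₁ y x else arc O₂ y x) ≡ true)
      choice-oneDir true  = oneDir O₁
      choice-oneDir false = oneDir O₂

      spliced-arc⇒edge : ∀ x y → splicedArc x y ≡ true → adj G x y ≡ true
      spliced-arc⇒edge x y = choice-arc⇒edge (sel x y) x y

      spliced-edge⇒arc : ∀ x y → adj G x y ≡ true → splicedArc x y ≡ true ⊎ splicedArc y x ≡ true
      spliced-edge⇒arc x y rewrite sel-comm y x = choice-edge⇒arc (sel x y) x y

      spliced-oneDir : ∀ x y → ¬ (splicedArc x y ≡ true × splicedArc y x ≡ true)
      spliced-oneDir x y rewrite sel-comm y x = choice-oneDir (sel x y) x y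

    splice : Orientation G
    splice = record
      { arc      = splicedArc
      ; arc⇒edge = spliced-arc⇒edge
      ; edge⇒arc = spliced-edge⇒arc
      ; oneDir   = spliced-oneDir
      }

  module _ (Om OM : Orientation G) where

    interpolate : ℕ → Orientation G
    interpolate k = splice (λ x y → does (edgeRank x y <? k))
                           (λ x y → cong (λ r → does (r <? k)) (edgeRank-comm x y)) OM Om

    interpolate-zero : ∀ x y → arc (interpolate 0) x y ≡ arc Om x y
    interpolate-zero x y =
      cong (λ b → if b then arc OM x y else arc Om x y) (dec-false (edgeRank x y <? 0) n≮0)

    interpolate-full : ∀ x y → arc (interpolate (n * n)) x y ≡ arc OM x y
    interpolate-full x y =
      cong (λ b → if b then arc OM x y else arc Om x y) (dec-true (edgeRank x y <? n * n) (edgeRank<n² x y))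

    interpolate-reversed : ∀ {k x y} → Reversed (interpolate k) (interpolate (suc k)) x y →
                           edgeRank x y ≡ k × arc Om x y ≡ true
    interpolate-reversed {k} {x} {y} = switched (edgeRank x y <? k) (edgeRank x y <? suc k)
      where
      switched : ∀ {r} {p q : Bool} (r<k? : Dec (r < k)) (r<1+k? : Dec (r < suc k)) →
                 (if does r<k? then p else q) ≡ true × (if does r<1+k? then p else q) ≡ false →
                 r ≡ k × q ≡ true
      switched (yes _)   (yes _)   (p , p′) = contradiction (trans (sym p) p′) true≢false
      switched (yes r<k) (no  r≮k) _        = contradiction (m<n⇒m<1+n r<k) r≮k
      switched (no  r≮k) (yes r<k) (q , _)  = ≤-antisym (≤-pred r<k) (≮⇒≥ r≮k) , q
      switched (no  _)   (no  _)   (q , q′) = contradiction (trans (sym q) q′) true≢false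

    interpolate-reversed-head : ∀ {k x y x′ y′} →
      Reversed (interpolate k) (interpolate (suc k)) x y →
      Reversed (interpolate k) (interpolate (suc k)) x′ y′ → y ≡ y′
    interpolate-reversed-head {k} {x} {y} {x′} {y′} rev rev′
      with interpolate-reversed {k} {x} {y} rev | interpolate-reversed {k} {x′} {y′} rev′
    ... | rank≡k , a | rank′≡k , a′
      with edgeRank-injective {x = x} {y} {x′} {y′} (trans rank≡k (sym rank′≡k))
    ...   | inj₁ (_ , y≡y′)     = y≡y′
    ...   | inj₂ (refl , refl) = contradiction (a , a′) (oneDir Om _ _)

mainTheorem2 : (t : ℕ) → 0 < t → (n : ℕ) → (G : Graph n) → (d D : ℕ)
    → IsMinGammaOver G t 1 d → IsMaxGammaOver G t 1 D
    → (b : ℕ) → d ≤ b → b ≤ D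
    → Σ (Orientation G) (λ O → IsGamma O t 1 b)
mainTheorem2 t 0<t n G d D ((Om , γOm) , _) ((OM , γOM) , _) b d≤b b≤D =
  let (k , γk≡b) = intermediate-value γ γ-step b (n * n) γ₀≤b b≤γN
  in  between k , subst (IsGamma (between k) t 1) γk≡b (γ-spec k)
  where
  between : ℕ → Orientation G
  between = interpolate Om OM

  γ : ℕ → ℕ
  γ k = proj₁ (gamma-exists (between k) 0<t)

  γ-spec : ∀ k → IsGamma (between k) t 1 (γ k)
  γ-spec k = proj₂ (gamma-exists (between k) 0<t)

  γ-step : ∀ k → γ (suc k) ≤ suc (γ k)
  γ-step k = gamma-step (interpolate-reversed-head Om OM) (γ-spec k) (γ-spec (suc k))

  γ₀≤b : γ 0 ≤ b
  γ₀≤b = ≤-trans (≤-reflexive (gamma-cong (interpolate-zero Om OM) (γ-spec 0) γOm)) d≤b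

  b≤γN : b ≤ γ (n * n)
  b≤γN = ≤-trans b≤D
    (≤-reflexive (gamma-cong (λ x y → sym (interpolate-full Om OM x y)) γOM (γ-spec (n * n))))
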